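{- For every finite string $w$ over $\{0,1\}$: $\phi(w)=0$ if and only if $\#w$ is even and $\xi(w)=0$.
   Context: $\#w$ is the length of $w$, $\varepsilon$ the empty string; for $\#w\ge1$, $l(w)$ is $w$ without its last letter and $r(w)$ is $w$ without its first letter. $T^n$ is the alternating string of length $n$ starting with $0$ ($T^0=\varepsilon$, $T^n=T^{n-1}0$ for odd $n$, $T^n=T^{n-1}1$ for even $n\ge2$) and $CT^n$ its letterwise complement. $\xi:\{0,1\}^*\to\{ -1,0,1\}$: $\xi(\varepsilon)=0$; $\xi(w)=1$ if $w=T^k$, $k\ge2$ even; $\xi(w)=-1$ if $w=CT^k$, $k\ge2$ even; otherwise $\xi(w)=\operatorname{sgn}(\xi(l(w))+\xi(r(w)))$. $\phi:\{0,1\}^*\to\{ -1,0,1\}$: $\phi(\varepsilon)=0$; $\phi(w)=-1$ if $w=0^k$, $k$ odd; $\phi(w)=1$ if $w=1^k$, $k$ odd; otherwise $\phi(w)=\operatorname{sgn}(\phi(r(w))-\phi(l(w)))$. -}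

module Defs where

open import Data.Bool using (Bool; true; false; not; if_then_else_)
open import Data.Bool.Properties using () renaming (_≟_ to _≟ᵇ_)
open import Data.Nat using (ℕ; zero; suc)
open import Data.Nat.Base using (_%_)
open import Data.Integer using (ℤ; +_; -[1+_]; _+_; _-_; -_)
open import Data.Vec using (Vec; []; _∷_; _∷ʳ_; tail; init; replicate; map)
open import Data.Vec.Properties using (≡-dec)
open import Relation.Nullary using (yes; no)

-- Binary strings of length n: Vec Bool n, with false = letter 0, true = letter 1.
-- # w is the length index n.

l : {n : ℕ} → Vec Bool (suc n) → Vec Bool n
l = init

r : {n : ℕ} → Vec Bool (suc n) → Vec Bool n
r = tail

isEven : ℕ → Bool
isEven zero = true
isEven (suc n) = not (isEven n)

T : (n : ℕ) → Vec Bool n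
T zero = []
T (suc n) = T n ∷ʳ (if isEven (suc n) then true else false)

CT : (n : ℕ) → Vec Bool n
CT n = map not (T n)

sgn : ℤ → ℤ
sgn (+ zero) = + 0
sgn (+ suc _) = + 1
sgn -[1+ _ ] = -[1+ 0 ]

eqᵇ : {n : ℕ} → Vec Bool n → Vec Bool n → Bool
eqᵇ w v with ≡-dec _≟ᵇ_ w v
... | yes _ = true
... | no _ = false

-- ξ (values in {-1,0,1} ⊆ ℤ).  For a word of length n, "w = T^k with k ≥ 2 even"
-- means n ≥ 2, n even and w = T^n (likewise for CT^k).
ξ : (n : ℕ) → Vec Bool n → ℤ
ξ zero [] = + 0
ξ (suc zero) w = sgn (ξ zero (l w) + ξ zero (r w))
ξ (suc (suc m)) w =
  if isEven m ∧' eqᵇ w (T (suc (suc m))) then + 1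
  else if isEven m ∧' eqᵇ w (CT (suc (suc m))) then -[1+ 0 ]
  else sgn (ξ (suc m) (l w) + ξ (suc m) (r w))
  where
  _∧'_ : Bool → Bool → Bool
  true ∧' b = b
  false ∧' _ = false

-- φ (values in {-1,0,1} ⊆ ℤ).  "w = 0^k, k odd" means n odd and w = 0^n.
φ : (n : ℕ) → Vec Bool n → ℤ
φ zero [] = + 0
φ (suc m) w =
  if isEven m ∧' eqᵇ w (replicate (suc m) false) then -[1+ 0 ]
  else if isEven m ∧' eqᵇ w (replicate (suc m) true) then + 1
  else sgn (φ m (r w) - φ m (l w))
  where
  _∧'_ : Bool → Bool → Bool
  true ∧' b = b
  false ∧' _ = false

-- The profile of a word (parity of its length; whether it is 0ⁿ, 1ⁿ, Tⁿ or CTⁿ;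
-- its values under ξ and φ) is a function of the profiles of its two maximal
-- proper factors, because both recursions only look at l(w) and r(w).  So the
-- profiles of the three factors of length n of a word of length n + 2 (its
-- window) evolve by a fixed finite rule as n grows.  Saturating the eight windows
-- of the words of length 3 under that rule gives a finite set of windows, closed
-- under the rule, in every member of which φ = 0 iff the length is even and ξ = 0.
module Submission where

open import Data.Bool using (Bool; true; false; _∧_; not; if_then_else_)
import Data.Bool.Properties as Bool
open import Data.Empty using (⊥-elim)
open import Data.Integer using (ℤ; +_; -[1+_])
import Data.Integer as ℤ
import Data.Integer.Properties as ℤ
open import Data.List as List using (List; []; _∷_; [_]; _++_; concatMap; deduplicate; cartesianProduct)
open import Data.List.Membership.Propositional using (_∈_)
open import Data.List.Membership.Propositional.Properties using (∈-map⁺; ∈-cartesianProduct⁺)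
open import Data.List.Relation.Unary.All as All using (All; all?)
open import Data.List.Relation.Unary.Any using (here; there)
open import Data.Nat using (ℕ; zero; suc; _+_)
open import Data.Product using (_×_; _,_; proj₁; proj₂; uncurry)
open import Data.Product.Properties using (,-injective)
open import Data.Vec using (Vec; []; _∷_; _∷ʳ_; head; tail; init; replicate; map)
import Data.Vec.Properties as Vec
open import Function using (_∘_; id)
open import Function.Bundles using (_⇔_; mk⇔; Equivalence)
open import Relation.Binary.Definitions using (DecidableEquality)
open import Relation.Binary.PropositionalEquality
  using (_≡_; refl; cong; cong₂; trans; sym; subst; module ≡-Reasoning)
open import Relation.Nullary using (Dec; does; yes; no)
open import Relation.Nullary.Decidable using (map′; _×-dec_; _→-dec_)

open import Defs

_⇔-dec_ : ∀ {A B : Set} → Dec A → Dec B → Dec (A ⇔ B)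
a? ⇔-dec b? = map′ (uncurry mk⇔) (λ e → Equivalence.to e , Equivalence.from e)
                   ((a? →-dec b?) ×-dec (b? →-dec a?))

-- Unlike Data.Product.Properties.≡-dec, the decision never forces an equality
-- proof, which keeps the evaluation behind reachable-invariant fast.
×-≟ : ∀ {A B : Set} → DecidableEquality A → DecidableEquality B → DecidableEquality (A × B)
×-≟ _≟₁_ _≟₂_ (a , b) (a′ , b′) = map′ (uncurry (cong₂ _,_)) ,-injective ((a ≟₁ a′) ×-dec (b ≟₂ b′))

decided : ∀ {A : Set} (a? : Dec A) → does a? ≡ true → A
decided (yes a) _ = a

module _ {A : Set} where

  init-tail-injective : ∀ {n} {x v : Vec A (2 + n)} → init x ≡ init v → tail x ≡ tail v → x ≡ v
  init-tail-injective {x = a ∷ x} {v = b ∷ v} p q = cong₂ _∷_ (cong head p) q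

  init-replicate : ∀ n (a : A) → init (replicate (suc n) a) ≡ replicate n a
  init-replicate zero    a = refl
  init-replicate (suc n) a = cong (a ∷_) (init-replicate n a)

  tail-∷ʳ : ∀ {n} (xs : Vec A (suc n)) a → tail (xs ∷ʳ a) ≡ tail xs ∷ʳ a
  tail-∷ʳ (x ∷ xs) a = refl

  module _ {B : Set} (f : A → B) where

    init-map : ∀ {n} (xs : Vec A (suc n)) → init (map f xs) ≡ map f (init xs)
    init-map (x ∷ [])     = refl
    init-map (x ∷ y ∷ xs) = cong (f x ∷_) (init-map (y ∷ xs))

    tail-map : ∀ {n} (xs : Vec A (suc n)) → tail (map f xs) ≡ map f (tail xs)
    tail-map (x ∷ xs) = refl

_≟ᵛ_ : ∀ {n} → DecidableEquality (Vec Bool n)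
_≟ᵛ_ = Vec.≡-dec Bool._≟_

eqᵇ-init-tail : ∀ {n} (x v : Vec Bool (2 + n)) →
                eqᵇ x v ≡ eqᵇ (init x) (init v) ∧ eqᵇ (tail x) (tail v)
eqᵇ-init-tail x v with x ≟ᵛ v | init x ≟ᵛ init v | tail x ≟ᵛ tail v
... | yes refl | yes _ | yes _ = refl
... | yes refl | no ¬p | _     = ⊥-elim (¬p refl)
... | yes refl | yes _ | no ¬q = ⊥-elim (¬q refl)
... | no ¬x≡v  | yes p | yes q = ⊥-elim (¬x≡v (init-tail-injective p q))
... | no _     | yes _ | no _  = refl
... | no _     | no _  | _     = refl

init-T : ∀ n → init (T (suc n)) ≡ T n
init-T n = Vec.init-∷ʳ _ (T n)

init-CT : ∀ n → init (CT (suc n)) ≡ CT n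
init-CT n = trans (init-map not (T (suc n))) (cong (map not) (init-T n))

tail-T : ∀ n → tail (T (suc n)) ≡ CT n
tail-T zero    = refl
tail-T (suc n) = begin
  tail (T (suc n) ∷ʳ letter (suc (suc n)))  ≡⟨ tail-∷ʳ (T (suc n)) _ ⟩
  tail (T (suc n)) ∷ʳ letter (suc (suc n))  ≡⟨ cong₂ _∷ʳ_ (tail-T n) (letter-suc (suc n)) ⟩
  CT n ∷ʳ not (letter (suc n))              ≡⟨ Vec.map-∷ʳ not (letter (suc n)) (T n) ⟨
  CT (suc n)                                ∎
  where
  open ≡-Reasoning
  letter : ℕ → Bool
  letter k = if isEven k then true else false
  letter-suc : ∀ k → letter (suc k) ≡ not (letter k)
  letter-suc k with isEven k
  ... | true  = refl
  ... | false = refl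

tail-CT : ∀ n → tail (CT (suc n)) ≡ T n
tail-CT n = begin
  tail (map not (T (suc n)))  ≡⟨ tail-map not (T (suc n)) ⟩
  map not (tail (T (suc n)))  ≡⟨ cong (map not) (tail-T n) ⟩
  map not (map not (T n))     ≡⟨ Vec.map-∘ not not (T n) ⟨
  map (not ∘ not) (T n)       ≡⟨ Vec.map-cong Bool.not-involutive (T n) ⟩
  map id (T n)                ≡⟨ Vec.map-id (T n) ⟩
  T n                         ∎
  where open ≡-Reasoning

module _ {n : ℕ} (x : Vec Bool (2 + n)) where

  eqᵇ-replicate-init-tail : ∀ b → eqᵇ x (replicate (2 + n) b) ≡
                            eqᵇ (init x) (replicate (1 + n) b) ∧ eqᵇ (tail x) (replicate (1 + n) b)
  eqᵇ-replicate-init-tail b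
    rewrite eqᵇ-init-tail x (replicate (2 + n) b) | init-replicate (1 + n) b = refl

  eqᵇ-T-init-tail : eqᵇ x (T (2 + n)) ≡ eqᵇ (init x) (T (1 + n)) ∧ eqᵇ (tail x) (CT (1 + n))
  eqᵇ-T-init-tail rewrite eqᵇ-init-tail x (T (2 + n)) | init-T (1 + n) | tail-T (1 + n) = refl

  eqᵇ-CT-init-tail : eqᵇ x (CT (2 + n)) ≡ eqᵇ (init x) (CT (1 + n)) ∧ eqᵇ (tail x) (T (1 + n))
  eqᵇ-CT-init-tail rewrite eqᵇ-init-tail x (CT (2 + n)) | init-CT (1 + n) | tail-CT (1 + n) = refl

override : Bool → ℤ → Bool → ℤ → ℤ → ℤ
override b₁ v₁ b₂ v₂ z = if b₁ then v₁ else if b₂ then v₂ else z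

module _ {n : ℕ} (x : Vec Bool (2 + n)) where

  ξ-unfold : ξ (2 + n) x ≡
             override (isEven (2 + n) ∧ eqᵇ x (T (2 + n))) (+ 1)
                      (isEven (2 + n) ∧ eqᵇ x (CT (2 + n))) -[1+ 0 ]
                      (sgn (ξ (1 + n) (init x) ℤ.+ ξ (1 + n) (tail x)))
  ξ-unfold with isEven n
  ... | true  = refl
  ... | false = refl

  φ-unfold : φ (2 + n) x ≡
             override (isEven (1 + n) ∧ eqᵇ x (replicate (2 + n) false)) -[1+ 0 ]
                      (isEven (1 + n) ∧ eqᵇ x (replicate (2 + n) true)) (+ 1)
                      (sgn (φ (1 + n) (tail x) ℤ.- φ (1 + n) (init x)))
  φ-unfold with isEven n
  ... | true  = refl
  ... | false = refl

Profile : Set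
Profile = Bool × Bool × Bool × Bool × Bool × ℤ × ℤ

profile : ∀ {n} → Vec Bool n → Profile
profile {n} w = isEven n , eqᵇ w (replicate n false) , eqᵇ w (replicate n true) ,
                eqᵇ w (T n) , eqᵇ w (CT n) , ξ n w , φ n w

extend : Profile → Profile → Profile
extend (e , z , o , t , c , x , p) (_ , z′ , o′ , t′ , c′ , x′ , p′) =
  not e , z ∧ z′ , o ∧ o′ , t ∧ c′ , c ∧ t′ ,
  override (not e ∧ (t ∧ c′)) (+ 1) (not e ∧ (c ∧ t′)) -[1+ 0 ] (sgn (x ℤ.+ x′)) ,
  override (e ∧ (z ∧ z′)) -[1+ 0 ] (e ∧ (o ∧ o′)) (+ 1) (sgn (p′ ℤ.- p))

profile-extend : ∀ {n} (x : Vec Bool (2 + n)) → profile x ≡ extend (profile (init x)) (profile (tail x))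
profile-extend x
  rewrite ξ-unfold x | φ-unfold x
        | eqᵇ-replicate-init-tail x false | eqᵇ-replicate-init-tail x true
        | eqᵇ-T-init-tail x | eqᵇ-CT-init-tail x = refl

-- Pairs of adjacent profiles would not do: the pairs generated from the letters by
-- the analogous rule include pairs whose profiles violate the theorem.
Window : Set
Window = Profile × Profile × Profile

window : ∀ {n} → Vec Bool (2 + n) → Window
window W = profile (init (init W)) , profile (init (tail W)) , profile (tail (tail W))

Overlap : Window → Window → Set
Overlap (_ , b , c) (b′ , c′ , _) = (b , c) ≡ (b′ , c′)

slide : Window → Window → Window
slide (a , b , c) (_ , _ , d) = extend a b , extend b c , extend c d

window-overlap : ∀ {n} (W : Vec Bool (3 + n)) → Overlap (window (init W)) (window (tail W))
window-overlap (a ∷ b ∷ W) = refl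

window-slide : ∀ {n} (W : Vec Bool (4 + n)) → window W ≡ slide (window (init W)) (window (tail W))
window-slide (a ∷ b ∷ W) = cong₂ _,_ (profile-extend _) (cong₂ _,_ (profile-extend _) (profile-extend _))

_≟ᵖ_ : DecidableEquality Profile
_≟ᵖ_ = ×-≟ Bool._≟_ (×-≟ Bool._≟_ (×-≟ Bool._≟_ (×-≟ Bool._≟_ (×-≟ Bool._≟_ (×-≟ ℤ._≟_ ℤ._≟_)))))

_≟ʷ_ : DecidableEquality Window
_≟ʷ_ = ×-≟ _≟ᵖ_ (×-≟ _≟ᵖ_ _≟ᵖ_)

overlap? : ∀ u v → Dec (Overlap u v)
overlap? (_ , b , c) (b′ , c′ , _) = ×-≟ _≟ᵖ_ _≟ᵖ_ (b , c) (b′ , c′)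

open import Data.List.Membership.DecPropositional _≟ʷ_ using (_∈?_; _∉?_)

bits : List Bool
bits = false ∷ true ∷ []

∈-bits : ∀ b → b ∈ bits
∈-bits false = here refl
∈-bits true  = there (here refl)

seed : Bool × Bool × Bool → Window
seed (a , b , c) = profile (a ∷ []) , profile (b ∷ []) , profile (c ∷ [])

seeds : List Window
seeds = List.map seed (cartesianProduct bits (cartesianProduct bits bits))

window∈seeds : ∀ a b c → window (a ∷ b ∷ c ∷ []) ∈ seeds
window∈seeds a b c = ∈-map⁺ seed (∈-cartesianProduct⁺ (∈-bits a) (∈-cartesianProduct⁺ (∈-bits b) (∈-bits c)))

successors : List Window → List Window
successors R = concatMap (λ u → concatMap (λ v → if does (overlap? u v) then [ slide u v ] else []) R) R

saturate : ℕ → List Window → List Window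
saturate zero    R = R
saturate (suc k) R = saturate k (R ++ deduplicate _≟ʷ_ (List.filter (_∉? R) (successors R)))

-- Six rounds reach the fixed point (152 windows); closure is checked, not assumed.
reachable : List Window
reachable = saturate 6 seeds

Closed : List Window → Set
Closed R = All (λ u → All (λ v → Overlap u v → slide u v ∈ R) R) R

ZeroCriterion : Profile → Set
ZeroCriterion (e , _ , _ , _ , _ , x , p) = (p ≡ + 0) ⇔ ((e ≡ true) × (x ≡ + 0))

zeroCriterion? : ∀ q → Dec (ZeroCriterion q)
zeroCriterion? (e , _ , _ , _ , _ , x , p) = (p ℤ.≟ + 0) ⇔-dec ((e Bool.≟ true) ×-dec (x ℤ.≟ + 0))

Invariant : List Window → Set
Invariant R = All (_∈ R) seeds × Closed R × All (ZeroCriterion ∘ proj₁) R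

invariant? : ∀ R → Dec (Invariant R)
invariant? R = all? (_∈? R) seeds
        ×-dec all? (λ u → all? (λ v → overlap? u v →-dec slide u v ∈? R) R) R
        ×-dec all? (zeroCriterion? ∘ proj₁) R

reachable-invariant : Invariant reachable
reachable-invariant = decided (invariant? reachable) refl

window∈reachable : ∀ {n} (W : Vec Bool (3 + n)) → window W ∈ reachable
window∈reachable {zero} (a ∷ b ∷ c ∷ []) = All.lookup seeds⊆reachable (window∈seeds a b c)
  where seeds⊆reachable = proj₁ reachable-invariant
window∈reachable {suc n} W =
  subst (_∈ reachable) (sym (window-slide W))
        (All.lookup (All.lookup closed (window∈reachable (init W))) (window∈reachable (tail W))
                    (window-overlap W))
  where closed = proj₁ (proj₂ reachable-invariant)

profile-zeroCriterion : ∀ {n} (w : Vec Bool (suc n)) → ZeroCriterion (profile w)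
profile-zeroCriterion w = subst (ZeroCriterion ∘ profile) padding-removed
  (All.lookup (proj₂ (proj₂ reachable-invariant)) (window∈reachable (w ∷ʳ false ∷ʳ false)))
  where
  padding-removed : init (init (w ∷ʳ false ∷ʳ false)) ≡ w
  padding-removed = trans (cong init (Vec.init-∷ʳ false (w ∷ʳ false))) (Vec.init-∷ʳ false w)

theorem4p2 : (n : ℕ) (w : Vec Bool n) →
    (φ n w ≡ + 0) ⇔ ((isEven n ≡ true) × (ξ n w ≡ + 0))
theorem4p2 zero    [] = mk⇔ (λ _ → refl , refl) (λ _ → refl)
theorem4p2 (suc n) w  = profile-zeroCriterion w
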